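{- Let $S$ be a finite non-empty set and $p:2^S\to\mathbb{Z}\cup\{ -\infty\}$ a supermodular function with $p(\emptyset)=0$ and $p(S)$ finite; let $B=\{x\in\mathbb{R}^S:\widetilde x(S)=p(S),\ \widetilde x(Z)\ge p(Z)\ \forall Z\subseteq S\}$, let $\beta_1$ be the smallest integer for which $B\cap\mathbb{Z}^S$ has a $\beta_1$-covered element, let $h_1(X)=p(X)-(\beta_1-1)|X|$, and let the peak-set $S_1$ be the intersection of all subsets of $S$ maximizing $h_1$. Then for every pre-decreasingly minimal (and in particular every decreasingly minimal) element $m$ of $B\cap\mathbb{Z}^S$ we have $S_1(m)=S_1$, where $S_1(m)=\bigcup\{T_m(t): m(t)=\beta_1\}$; in particular $S_1(m)$ does not depend on the choice of $m$.
   Context: $\widetilde x(Z)=\sum_{s\in Z}x(s)$. A vector is $\beta$-covered if each of its components is at most $\beta$. For $m\in B$, $X$ is $m$-tight if $\widetilde m(X)=p(X)$, and $T_m(t)$ is the unique smallest $m$-tight set containing $t$. A $\beta_1$-covered element of $B\cap\mathbb{Z}^S$ is pre-decreasingly minimal if the number of its $\beta_1$-valued components is minimum among $\beta_1$-covered elements of $B\cap\mathbb{Z}^S$. An element $m$ of a set $Q$ is decreasingly minimal if its components sorted in decreasing order form a lexicographically smallest-or-equal sequence compared to every $y\in Q$ sorted likewise. -}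

module Defs where

open import Data.Nat using (ℕ; suc)
open import Data.Integer using (ℤ; _+_; _-_; _*_; _≤_; +_; 0ℤ; 1ℤ)
open import Data.Integer.Properties using (_≟_)
open import Data.Fin using (Fin)
open import Data.Fin.Subset using (Subset; _∈_; _∩_; _∪_; ⊥; ⊤; ∣_∣; inside; outside; _⊆_)
open import Data.Vec using (lookup)
open import Data.List using (List; foldr; map; filter; length)
open import Data.List.Base using () renaming (allFin to allFinL)
open import Data.Product using (Σ; _×_; ∃)
open import Relation.Binary.PropositionalEquality using (_≡_)
open import Function.Bundles using (_⇔_)

data ℤ∞ : Set where
  -∞  : ℤ∞
  fin : ℤ → ℤ∞

infixl 6 _+∞_
_+∞_ : ℤ∞ → ℤ∞ → ℤ∞
-∞    +∞ _     = -∞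
fin _ +∞ -∞    = -∞
fin a +∞ fin b = fin (a + b)

infix 4 _≤∞_
data _≤∞_ : ℤ∞ → ℤ∞ → Set where
  -∞≤  : ∀ {y} → -∞ ≤∞ y
  fin≤ : ∀ {a b} → a ≤ b → fin a ≤∞ fin b

_⊖∞_ : ℤ∞ → ℤ → ℤ∞
-∞    ⊖∞ _ = -∞
fin a ⊖∞ b = fin (a - b)

Supermodular : ∀ {n} → (Subset n → ℤ∞) → Set
Supermodular p = ∀ X Y → p X +∞ p Y ≤∞ p (X ∩ Y) +∞ p (X ∪ Y)

sumℤ : List ℤ → ℤ
sumℤ = foldr _+_ 0ℤ

sel : ∀ {n} → Subset n → (Fin n → ℤ) → Fin n → ℤ
sel Z x i with lookup Z i
... | inside  = x i
... | outside = 0ℤ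

tilde : ∀ {n} → (Fin n → ℤ) → Subset n → ℤ
tilde {n} x Z = sumℤ (map (sel Z x) (allFinL n))

InB : ∀ {n} → (Subset n → ℤ∞) → (Fin n → ℤ) → Set
InB p x = (fin (tilde x ⊤) ≡ p ⊤) × (∀ Z → p Z ≤∞ fin (tilde x Z))

Covered : ∀ {n} → ℤ → (Fin n → ℤ) → Set
Covered β x = ∀ s → x s ≤ β

IsBeta1 : ∀ {n} → (Subset n → ℤ∞) → ℤ → Set
IsBeta1 p β = (∃ λ x → InB p x × Covered β x)
            × (∀ β' → (∃ λ x → InB p x × Covered β' x) → β ≤ β')

h1 : ∀ {n} → (Subset n → ℤ∞) → ℤ → Subset n → ℤ∞
h1 p β X = p X ⊖∞ ((β - 1ℤ) * + ∣ X ∣)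

Maximizes : ∀ {n} → (Subset n → ℤ∞) → Subset n → Set
Maximizes h X = ∀ Y → h Y ≤∞ h X

IsPeakSet : ∀ {n} → (Subset n → ℤ∞) → ℤ → Subset n → Set
IsPeakSet p β S₁ = ∀ s → (s ∈ S₁) ⇔ (∀ X → Maximizes (h1 p β) X → s ∈ X)

countEq : ∀ {n} → (Fin n → ℤ) → ℤ → ℕ
countEq {n} x b = length (filter (λ i → x i ≟ b) (allFinL n))

PreDecMin : ∀ {n} → (Subset n → ℤ∞) → ℤ → (Fin n → ℤ) → Set
PreDecMin p β m = InB p m × Covered β m
                × (∀ y → InB p y → Covered β y → countEq m β Data.Nat.≤ countEq y β)

Tight : ∀ {n} → (Subset n → ℤ∞) → (Fin n → ℤ) → Subset n → Set
Tight p m X = fin (tilde m X) ≡ p X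

IsTm : ∀ {n} → (Subset n → ℤ∞) → (Fin n → ℤ) → Fin n → Subset n → Set
IsTm p m t T = Tight p m T × t ∈ T × (∀ X → Tight p m X → t ∈ X → T ⊆ X)

IsS1m : ∀ {n} → (Subset n → ℤ∞) → ℤ → (Fin n → ℤ) → Subset n → Set
IsS1m p β m U = ∀ s → (s ∈ U) ⇔ (∃ λ t → (m t ≡ β) × (∃ λ T → IsTm p m t T × s ∈ T))

-- Let K be the number of β₁-valued components of m. As m is β₁-covered, m̃(X) ≤ (β₁ − 1)|X| + K
-- for every X, strictly if some β₁-valued component lies outside X, and with equality if X contains
-- all of them and no component below β₁ − 1; together with p ≤ m̃ this gives h₁ ≤ K everywhere.
-- Supermodularity of p against modularity of m̃ makes the m-tight sets a lattice, so S₁(m) is tight.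
-- No s ∈ S₁(m) has m(s) < β₁ − 1: if s ∈ T_m(t) with m(t) = β₁, moving one unit from t to s stays
-- in B and lowers the number of β₁-valued components. Hence h₁(S₁(m)) = K and S₁(m) maximizes h₁,
-- while every maximizer X is tight and contains every β₁-valued t, hence every T_m(t). So S₁(m) is
-- the least maximizer, which is the peak set.
module Submission where

open import Defs
open import Data.Nat as ℕ using (ℕ; zero; suc; z≤n; s≤s)
open import Data.Integer using (ℤ; 0ℤ; 1ℤ; -1ℤ; +_; -_; _+_; _-_; _*_; _≤_; _<_; +≤+; +<+)
import Data.Nat.Properties as ℕP
import Data.Integer.Properties as ℤP
open import Data.Integer.Tactic.RingSolver using (solve-∀)
open import Data.Fin using (Fin; zero; suc; punchIn)
import Data.Fin.Properties as FinP
open import Data.Fin.Subset using (Subset; inside; outside; ⊥; ⊤; _∈_; _∉_; _⊆_; _∩_; _∪_; ⋂; ⋃; ∣_∣)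
open import Data.Fin.Subset.Properties using (_∈?_; ∈⊤; ∉⊥; x∈p∩q⁺; x∈p∩q⁻; x∈p∪q⁺; x∈p∪q⁻)
open import Data.Vec using (_∷_; []; lookup)
open import Data.Vec.Properties using ([]=⇒lookup; lookup⇒[]=)
open import Data.List using (List; []; _∷_; map; filter; length; tabulate; _++_)
open import Data.List.Base using () renaming (allFin to allFinL)
open import Data.List.Properties using (map-tabulate; foldr-preservesᵇ)
open import Data.List.Relation.Unary.All as All using (All)
open import Data.List.Relation.Unary.All.Properties using (all-filter; map⁺)
open import Data.List.Relation.Unary.Any using (here; there)
open import Data.List.Membership.Propositional using () renaming (_∈_ to _∈ₗ_)
open import Data.List.Membership.Propositional.Properties
  using (∈-allFin; ∈-map⁺; ∈-map⁻; ∈-filter⁺; ∈-filter⁻; ∈-++⁺ˡ; ∈-++⁺ʳ)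
open import Data.Product as Product using (∃; _×_; _,_; proj₁; proj₂)
open import Data.Sum using (_⊎_; inj₁; inj₂; [_,_]′)
open import Data.Empty using (⊥-elim)
open import Function using (_∘_; id)
open import Function.Bundles using (mk⇔; Equivalence)
open import Relation.Nullary using (Dec; yes; no; ¬_)
open import Relation.Nullary.Decidable using (_×-dec_; map′)
open import Relation.Unary using (Pred; Decidable)
open import Relation.Binary.PropositionalEquality
open import Algebra.Properties.CommutativeMonoid.Sum ℤP.+-0-commutativeMonoid
  using (sum; sum-syntax; ∑-distrib-+; sum-cong-≗; sum-remove; sum-replicate-zero)

private
  variable
    n : ℕ

m+n-m≡n : ∀ m n → m + n - m ≡ n
m+n-m≡n = solve-∀

m+n-n≡m : ∀ m n → m + n - n ≡ m
m+n-n≡m = solve-∀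

m+[n-m]≡n : ∀ m n → m + (n - m) ≡ n
m+[n-m]≡n = solve-∀

m-1+1≡m : ∀ m → m - 1ℤ + 1ℤ ≡ m
m-1+1≡m = solve-∀

+-cancelʳ-≤ : ∀ {a b} c → a + c ≤ b + c → a ≤ b
+-cancelʳ-≤ {a} {b} c a+c≤b+c = begin
  a           ≡⟨ m+n-n≡m a c ⟨
  a + c - c   ≤⟨ ℤP.+-monoˡ-≤ (- c) a+c≤b+c ⟩
  b + c - c   ≡⟨ m+n-n≡m b c ⟩
  b           ∎
  where open ℤP.≤-Reasoning

+-cancelʳ-≡ : ∀ {a b} c → a + c ≡ b + c → a ≡ b
+-cancelʳ-≡ c a+c≡b+c =
  ℤP.≤-antisym (+-cancelʳ-≤ c (ℤP.≤-reflexive a+c≡b+c)) (+-cancelʳ-≤ c (ℤP.≤-reflexive (sym a+c≡b+c)))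

+≡+∧≤⇒≥ : ∀ {a b c d} → a + c ≡ b + d → c ≤ d → b ≤ a
+≡+∧≤⇒≥ {a} {b} {c} a+c≡b+d c≤d =
  +-cancelʳ-≤ c (ℤP.≤-trans (ℤP.+-monoʳ-≤ b c≤d) (ℤP.≤-reflexive (sym a+c≡b+d)))

<+1⇒≤ : ∀ {a b} → a < b + 1ℤ → a ≤ b
<+1⇒≤ {a} a<b+1 = +-cancelʳ-≤ 1ℤ (subst (_≤ _) (ℤP.+-comm 1ℤ a) (ℤP.i<j⇒suc[i]≤j a<b+1))

<⇒≤-1 : ∀ {a b} → a < b → a ≤ b - 1ℤ
<⇒≤-1 {b = b} a<b = <+1⇒≤ (subst (_ <_) (sym (m-1+1≡m b)) a<b)

≤-1⇒< : ∀ {a b} → a ≤ b - 1ℤ → a < b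
≤-1⇒< {b = b} a≤b-1 = ℤP.i≤pred[j]⇒i<j (subst (_ ≤_) (ℤP.+-comm b -1ℤ) a≤b-1)

+-squeezeˡ : ∀ {a b c d} → c ≤ a → d ≤ b → a + b ≤ c + d → c ≡ a
+-squeezeˡ c≤a d≤b a+b≤c+d =
  ℤP.≤-antisym c≤a (ℤP.≮⇒≥ λ c<a → ℤP.<⇒≱ (ℤP.+-mono-<-≤ c<a d≤b) a+b≤c+d)

fin-injective : ∀ {a b} → fin a ≡ fin b → a ≡ b
fin-injective refl = refl

_≟∞_ : (u v : ℤ∞) → Dec (u ≡ v)
-∞    ≟∞ -∞    = yes refl
-∞    ≟∞ fin _ = no λ ()
fin _ ≟∞ -∞    = no λ ()
fin a ≟∞ fin b = map′ (cong fin) fin-injective (a ℤP.≟ b)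

≤∞-weaken : ∀ {u a b} → u ≤∞ fin a → a ≤ b → u ≤∞ fin b
≤∞-weaken -∞≤         _   = -∞≤
≤∞-weaken (fin≤ c≤a) a≤b = fin≤ (ℤP.≤-trans c≤a a≤b)

≤∞-pred : ∀ {u a} → u ≤∞ fin (a + 1ℤ) → u ≢ fin (a + 1ℤ) → u ≤∞ fin a
≤∞-pred -∞≤           _     = -∞≤
≤∞-pred (fin≤ c≤a+1) c≢a+1 = fin≤ (<+1⇒≤ (ℤP.≤∧≢⇒< c≤a+1 (c≢a+1 ∘ cong fin)))

≤∞-squeeze : ∀ {u v a b} → u ≤∞ fin a → v ≤∞ fin b → fin (a + b) ≤∞ u +∞ v →
             u ≡ fin a × v ≡ fin b
≤∞-squeeze {a = a} {b} (fin≤ {c} c≤a) (fin≤ {d} d≤b) (fin≤ a+b≤c+d) =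
  cong fin (+-squeezeˡ c≤a d≤b a+b≤c+d) ,
  cong fin (+-squeezeˡ d≤b c≤a (subst₂ _≤_ (ℤP.+-comm a b) (ℤP.+-comm c d) a+b≤c+d))

⊖∞-≤ : ∀ {u a d k} → u ≤∞ fin a → a ≤ d + k → u ⊖∞ d ≤∞ fin k
⊖∞-≤ -∞≤                       _     = -∞≤
⊖∞-≤ {d = d} {k} (fin≤ {c} c≤a) a≤d+k = fin≤ (begin
  c - d       ≤⟨ ℤP.+-monoˡ-≤ (- d) (ℤP.≤-trans c≤a a≤d+k) ⟩
  d + k - d   ≡⟨ m+n-m≡n d k ⟩
  k           ∎)
  where open ℤP.≤-Reasoning

⊖∞-sandwich : ∀ {u a d k} → u ≤∞ fin a → a ≤ d + k → fin k ≤∞ u ⊖∞ d →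
              u ≡ fin a × a ≡ d + k
⊖∞-sandwich {d = d} {k} (fin≤ {c} c≤a) a≤d+k (fin≤ k≤c-d) =
  cong fin (ℤP.≤-antisym c≤a (ℤP.≤-trans a≤d+k d+k≤c)) ,
  ℤP.≤-antisym a≤d+k (ℤP.≤-trans d+k≤c c≤a)
  where
  d+k≤c : d + k ≤ c
  d+k≤c = subst (d + k ≤_) (m+[n-m]≡n d c) (ℤP.+-monoʳ-≤ d k≤c-d)

⊖∞-fin : ∀ {u d k} → u ≡ fin (d + k) → u ⊖∞ d ≡ fin k
⊖∞-fin {d = d} {k} refl = cong fin (m+n-m≡n d k)

𝟙 : ∀ {a} {A : Set a} → Dec A → ℤ
𝟙 (yes _) = 1ℤ
𝟙 (no _)  = 0ℤ

𝟙-yes : ∀ {a} {A : Set a} (d : Dec A) → A → 𝟙 d ≡ 1ℤ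
𝟙-yes (yes _) _ = refl
𝟙-yes (no ¬a) a = ⊥-elim (¬a a)

𝟙-no : ∀ {a} {A : Set a} (d : Dec A) → ¬ A → 𝟙 d ≡ 0ℤ
𝟙-no (yes a) ¬a = ⊥-elim (¬a a)
𝟙-no (no _)  _  = refl

0≤𝟙 : ∀ {a} {A : Set a} (d : Dec A) → 0ℤ ≤ 𝟙 d
0≤𝟙 (yes _) = +≤+ z≤n
0≤𝟙 (no _)  = ℤP.≤-refl

∑-mono-≤ : ∀ {f g : Fin n → ℤ} → (∀ i → f i ≤ g i) → sum f ≤ sum g
∑-mono-≤ {zero}  _   = ℤP.≤-refl
∑-mono-≤ {suc n} f≤g = ℤP.+-mono-≤ (f≤g zero) (∑-mono-≤ (f≤g ∘ suc))

∑-mono-< : ∀ {f g : Fin n → ℤ} (t : Fin n) → (∀ i → f i ≤ g i) → f t < g t → sum f < sum g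
∑-mono-< {suc n} {f} {g} t f≤g ft<gt = begin-strict
  sum f                    ≡⟨ sum-remove {i = t} f ⟩
  f t + sum (f ∘ punchIn t) <⟨ ℤP.+-mono-<-≤ ft<gt (∑-mono-≤ (f≤g ∘ punchIn t)) ⟩
  g t + sum (g ∘ punchIn t) ≡⟨ sum-remove {i = t} g ⟨
  sum g                    ∎
  where open ℤP.≤-Reasoning

∑-single : ∀ {f : Fin n → ℤ} (a : Fin n) → (∀ i → i ≢ a → f i ≡ 0ℤ) → sum f ≡ f a
∑-single {suc n} {f} a f≡0 = begin
  sum f                     ≡⟨ sum-remove {i = a} f ⟩
  f a + sum (f ∘ punchIn a) ≡⟨ cong (λ r → f a + r) (trans (sum-cong-≗ rest≡0) (sum-replicate-zero n)) ⟩
  f a + 0ℤ                  ≡⟨ ℤP.+-identityʳ (f a) ⟩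
  f a                       ∎
  where
  open ≡-Reasoning
  rest≡0 : ∀ j → f (punchIn a j) ≡ 0ℤ
  rest≡0 j = f≡0 (punchIn a j) (FinP.punchInᵢ≢i a j)

sumℤ-map-allFin : ∀ (f : Fin n → ℤ) → sumℤ (map f (allFinL n)) ≡ sum f
sumℤ-map-allFin {n} f = trans (cong sumℤ (map-tabulate id f)) (sumℤ-tabulate f)
  where
  sumℤ-tabulate : ∀ {n} (g : Fin n → ℤ) → sumℤ (tabulate g) ≡ sum g
  sumℤ-tabulate {zero}  g = refl
  sumℤ-tabulate {suc n} g = cong (λ r → g zero + r) (sumℤ-tabulate (g ∘ suc))

sel-∈ : ∀ {Z : Subset n} (x : Fin n → ℤ) {i} → i ∈ Z → sel Z x i ≡ x i
sel-∈ {Z = Z} x {i} i∈Z with lookup Z i | []=⇒lookup i∈Z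
... | inside | _ = refl

sel-∉ : ∀ {Z : Subset n} (x : Fin n → ℤ) {i} → i ∉ Z → sel Z x i ≡ 0ℤ
sel-∉ {Z = Z} x {i} i∉Z with lookup Z i in eq
... | inside  = ⊥-elim (i∉Z (lookup⇒[]= i Z eq))
... | outside = refl

sel-suc : ∀ b (X : Subset n) (x : Fin (suc n) → ℤ) i → sel (b ∷ X) x (suc i) ≡ sel X (x ∘ suc) i
sel-suc b X x i with lookup X i
... | inside  = refl
... | outside = refl

tilde≡∑ : ∀ (x : Fin n → ℤ) Z → tilde x Z ≡ sum (sel Z x)
tilde≡∑ x Z = sumℤ-map-allFin (sel Z x)

tilde-+-tilde : ∀ (x y : Fin n → ℤ) Z W → tilde x Z + tilde y W ≡ ∑[ i < n ] (sel Z x i + sel W y i)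
tilde-+-tilde x y Z W =
  trans (cong₂ _+_ (tilde≡∑ x Z) (tilde≡∑ y W)) (sym (∑-distrib-+ (sel Z x) (sel W y)))

tilde-⊥ : ∀ (x : Fin n → ℤ) → tilde x ⊥ ≡ 0ℤ
tilde-⊥ {n} x =
  trans (tilde≡∑ x ⊥) (trans (sum-cong-≗ (λ i → sel-∉ x (∉⊥ {x = i}))) (sum-replicate-zero n))

tilde-modular : ∀ (x : Fin n → ℤ) X Y → tilde x (X ∩ Y) + tilde x (X ∪ Y) ≡ tilde x X + tilde x Y
tilde-modular x X Y =
  trans (tilde-+-tilde x x (X ∩ Y) (X ∪ Y)) (trans (sum-cong-≗ pointwise) (sym (tilde-+-tilde x x X Y)))
  where
  pointwise : ∀ i → sel (X ∩ Y) x i + sel (X ∪ Y) x i ≡ sel X x i + sel Y x i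
  pointwise i with i ∈? X | i ∈? Y
  ... | yes i∈X | yes i∈Y
    rewrite sel-∈ x (x∈p∩q⁺ (i∈X , i∈Y)) | sel-∈ x (x∈p∪q⁺ {p = X} {q = Y} (inj₁ i∈X))
          | sel-∈ x i∈X | sel-∈ x i∈Y = refl
  ... | yes i∈X | no i∉Y
    rewrite sel-∉ x (i∉Y ∘ proj₂ ∘ x∈p∩q⁻ X Y) | sel-∈ x (x∈p∪q⁺ {p = X} {q = Y} (inj₁ i∈X))
          | sel-∈ x i∈X | sel-∉ x i∉Y = ℤP.+-comm 0ℤ (x i)
  ... | no i∉X | yes i∈Y
    rewrite sel-∉ x (i∉X ∘ proj₁ ∘ x∈p∩q⁻ X Y) | sel-∈ x (x∈p∪q⁺ {p = X} {q = Y} (inj₂ i∈Y))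
          | sel-∉ x i∉X | sel-∈ x i∈Y = refl
  ... | no i∉X | no i∉Y
    rewrite sel-∉ x (i∉X ∘ proj₁ ∘ x∈p∩q⁻ X Y) | sel-∉ x ([ i∉X , i∉Y ]′ ∘ x∈p∪q⁻ X Y)
          | sel-∉ x i∉X | sel-∉ x i∉Y = refl

tilde-const : ∀ (c : ℤ) (X : Subset n) → tilde (λ _ → c) X ≡ c * + ∣ X ∣
tilde-const c X = trans (tilde≡∑ _ X) (∑-sel-const X)
  where
  ∑-sel-const : ∀ {n} (X : Subset n) → sum (sel X (λ _ → c)) ≡ c * + ∣ X ∣
  ∑-sel-const []           = sym (ℤP.*-zeroʳ c)
  ∑-sel-const (inside ∷ X) = begin
    c + sum (sel (inside ∷ X) (λ _ → c) ∘ suc) ≡⟨ cong (λ r → c + r) (sum-cong-≗ (sel-suc inside X _)) ⟩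
    c + sum (sel X (λ _ → c))                  ≡⟨ cong (λ r → c + r) (∑-sel-const X) ⟩
    c + c * + ∣ X ∣                            ≡⟨ ℤP.*-suc c (+ ∣ X ∣) ⟨
    c * + suc ∣ X ∣                            ∎
    where open ≡-Reasoning
  ∑-sel-const (outside ∷ X) = begin
    0ℤ + sum (sel (outside ∷ X) (λ _ → c) ∘ suc) ≡⟨ ℤP.+-identityˡ _ ⟩
    sum (sel (outside ∷ X) (λ _ → c) ∘ suc)      ≡⟨ sum-cong-≗ (sel-suc outside X _) ⟩
    sum (sel X (λ _ → c))                        ≡⟨ ∑-sel-const X ⟩
    c * + ∣ X ∣                                  ∎
    where open ≡-Reasoning

+length-filter : ∀ {a p} {A : Set a} {P : Pred A p} (P? : Decidable P) (l : List A) →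
                 + length (filter P? l) ≡ sumℤ (map (𝟙 ∘ P?) l)
+length-filter P? []      = refl
+length-filter P? (a ∷ l) with P? a
... | yes _ = cong (λ r → 1ℤ + r) (+length-filter P? l)
... | no _  = trans (+length-filter P? l) (sym (ℤP.+-identityˡ _))

countEq≡∑ : ∀ (x : Fin n → ℤ) b → + countEq x b ≡ ∑[ i < n ] 𝟙 (x i ℤP.≟ b)
countEq≡∑ {n} x b = trans (+length-filter _ (allFinL n)) (sumℤ-map-allFin {n} (λ i → 𝟙 (x i ℤP.≟ b)))

countEq-< : ∀ {x y : Fin n → ℤ} {b} (t : Fin n) → (∀ i → y i ≡ b → x i ≡ b) → x t ≡ b → y t ≢ b →
            countEq y b ℕ.< countEq x b
countEq-< {x = x} {y} {b} t y≡b⇒x≡b xt≡b yt≢b =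
  ℤP.drop‿+<+ (subst₂ _<_ (sym (countEq≡∑ y b)) (sym (countEq≡∑ x b)) (∑-mono-< t 𝟙y≤𝟙x 𝟙yt<𝟙xt))
  where
  𝟙y≤𝟙x : ∀ i → 𝟙 (y i ℤP.≟ b) ≤ 𝟙 (x i ℤP.≟ b)
  𝟙y≤𝟙x i with y i ℤP.≟ b
  ... | yes yi≡b = ℤP.≤-reflexive (sym (𝟙-yes (x i ℤP.≟ b) (y≡b⇒x≡b i yi≡b)))
  ... | no _     = 0≤𝟙 (x i ℤP.≟ b)
  𝟙yt<𝟙xt : 𝟙 (y t ℤP.≟ b) < 𝟙 (x t ℤP.≟ b)
  𝟙yt<𝟙xt rewrite 𝟙-no (y t ℤP.≟ b) yt≢b | 𝟙-yes (x t ℤP.≟ b) xt≡b = +<+ (s≤s z≤n)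

allSubsets : ∀ n → List (Subset n)
allSubsets zero    = [] ∷ []
allSubsets (suc n) = map (inside ∷_) (allSubsets n) ++ map (outside ∷_) (allSubsets n)

∈-allSubsets : ∀ (X : Subset n) → X ∈ₗ allSubsets n
∈-allSubsets []                      = here refl
∈-allSubsets {suc n} (inside ∷ X)  = ∈-++⁺ˡ (∈-map⁺ (inside ∷_) (∈-allSubsets X))
∈-allSubsets {suc n} (outside ∷ X) =
  ∈-++⁺ʳ (map (inside ∷_) (allSubsets n)) (∈-map⁺ (outside ∷_) (∈-allSubsets X))

⋂-⊆ : ∀ {X} {Xs : List (Subset n)} → X ∈ₗ Xs → ⋂ Xs ⊆ X
⋂-⊆ {Xs = Y ∷ Ys} (here refl)  s∈⋂ = proj₁ (x∈p∩q⁻ Y (⋂ Ys) s∈⋂)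
⋂-⊆ {Xs = Y ∷ Ys} (there X∈Ys) s∈⋂ = ⋂-⊆ X∈Ys (proj₂ (x∈p∩q⁻ Y (⋂ Ys) s∈⋂))

∈⋃⁺ : ∀ {X} {Xs : List (Subset n)} → X ∈ₗ Xs → X ⊆ ⋃ Xs
∈⋃⁺ (here refl)                  s∈X = x∈p∪q⁺ (inj₁ s∈X)
∈⋃⁺ {Xs = Y ∷ _} (there X∈Xs) s∈X = x∈p∪q⁺ {p = Y} (inj₂ (∈⋃⁺ X∈Xs s∈X))

∈⋃⁻ : ∀ {s} (Xs : List (Subset n)) → s ∈ ⋃ Xs → ∃ λ X → X ∈ₗ Xs × s ∈ X
∈⋃⁻ []       s∈⊥ = ⊥-elim (∉⊥ s∈⊥)
∈⋃⁻ (X ∷ Xs) s∈⋃ with x∈p∪q⁻ X (⋃ Xs) s∈⋃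
... | inj₁ s∈X   = X , here refl , s∈X
... | inj₂ s∈⋃Xs = let Y , Y∈Xs , s∈Y = ∈⋃⁻ Xs s∈⋃Xs in Y , there Y∈Xs , s∈Y

module _ {n ℓ} {Q : Pred (Subset n) ℓ} (Q? : Decidable Q) where

  ⋂-all : Subset n
  ⋂-all = ⋂ (filter Q? (allSubsets n))

  ⋂-all-⊆ : ∀ {X} → Q X → ⋂-all ⊆ X
  ⋂-all-⊆ {X} QX = ⋂-⊆ (∈-filter⁺ Q? (∈-allSubsets X) QX)

  ⋂-all-closed : Q ⊤ → (∀ {X Y} → Q X → Q Y → Q (X ∩ Y)) → Q ⋂-all
  ⋂-all-closed Q⊤ Q∩ = foldr-preservesᵇ Q∩ Q⊤ (all-filter Q? (allSubsets n))

δ : Fin n → Fin n → ℤ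
δ a i = 𝟙 (a FinP.≟ i)

transfer : Fin n → Fin n → (Fin n → ℤ) → Fin n → ℤ
transfer s t x i = x i + δ s i - δ t i

tilde-δ : ∀ (a : Fin n) Z → tilde (δ a) Z ≡ 𝟙 (a ∈? Z)
tilde-δ a Z = trans (tilde≡∑ (δ a) Z) (trans (∑-single a elsewhere) at-a)
  where
  elsewhere : ∀ i → i ≢ a → sel Z (δ a) i ≡ 0ℤ
  elsewhere i i≢a with i ∈? Z
  ... | yes i∈Z = trans (sel-∈ (δ a) i∈Z) (𝟙-no (a FinP.≟ i) (i≢a ∘ sym))
  ... | no i∉Z  = sel-∉ (δ a) i∉Z
  at-a : sel Z (δ a) a ≡ 𝟙 (a ∈? Z)
  at-a with a ∈? Z
  ... | yes a∈Z = trans (sel-∈ (δ a) a∈Z) (𝟙-yes (a FinP.≟ a) refl)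
  ... | no a∉Z  = sel-∉ (δ a) a∉Z

tilde-transfer : ∀ s t (x : Fin n → ℤ) Z →
                 tilde (transfer s t x) Z + 𝟙 (t ∈? Z) ≡ tilde x Z + 𝟙 (s ∈? Z)
tilde-transfer {n} s t x Z = begin
  tilde y Z + 𝟙 (t ∈? Z)                   ≡⟨ cong (λ r → tilde y Z + r) (tilde-δ t Z) ⟨
  tilde y Z + tilde (δ t) Z                ≡⟨ tilde-+-tilde y (δ t) Z Z ⟩
  ∑[ i < n ] (sel Z y i + sel Z (δ t) i)   ≡⟨ sum-cong-≗ pointwise ⟩
  ∑[ i < n ] (sel Z x i + sel Z (δ s) i)   ≡⟨ tilde-+-tilde x (δ s) Z Z ⟨
  tilde x Z + tilde (δ s) Z                ≡⟨ cong (λ r → tilde x Z + r) (tilde-δ s Z) ⟩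
  tilde x Z + 𝟙 (s ∈? Z)                   ∎
  where
  open ≡-Reasoning
  y : Fin n → ℤ
  y = transfer s t x
  m-n+n≡m : ∀ m n → m - n + n ≡ m
  m-n+n≡m = solve-∀
  pointwise : ∀ i → sel Z y i + sel Z (δ t) i ≡ sel Z x i + sel Z (δ s) i
  pointwise i with i ∈? Z
  ... | yes i∈Z rewrite sel-∈ y i∈Z | sel-∈ (δ t) i∈Z | sel-∈ x i∈Z | sel-∈ (δ s) i∈Z =
    m-n+n≡m (x i + δ s i) (δ t i)
  ... | no i∉Z  rewrite sel-∉ y i∉Z | sel-∉ (δ t) i∉Z | sel-∉ x i∉Z | sel-∉ (δ s) i∉Z = refl

InTightHull : (Subset n → ℤ∞) → (Fin n → ℤ) → Fin n → Fin n → Set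
InTightHull p x t s = ∀ Z → Tight p x Z → t ∈ Z → s ∈ Z

transfer-InB : ∀ {p : Subset n → ℤ∞} {x s t} → InB p x → InTightHull p x t s → InB p (transfer s t x)
transfer-InB {p = p} {x} {s} {t} (x-⊤ , x-lb) t⇒s = y-⊤ , y-lb
  where
  y : Fin _ → ℤ
  y = transfer s t x

  y-⊤ : fin (tilde y ⊤) ≡ p ⊤
  y-⊤ = trans (cong fin (+-cancelʳ-≡ 1ℤ y+1≡x+1)) x-⊤
    where
    y+1≡x+1 : tilde y ⊤ + 1ℤ ≡ tilde x ⊤ + 1ℤ
    y+1≡x+1 = subst₂ (λ a b → tilde y ⊤ + a ≡ tilde x ⊤ + b)
                (𝟙-yes (t ∈? ⊤) ∈⊤) (𝟙-yes (s ∈? ⊤) ∈⊤) (tilde-transfer s t x ⊤)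

  -- The only sets whose y-value drops are those containing t but not s; they are not x-tight.
  y-lb : ∀ Z → p Z ≤∞ fin (tilde y Z)
  y-lb Z with t ∈? Z | s ∈? Z | tilde-transfer s t x Z
  ... | yes t∈Z | no s∉Z  | y+1≡x+0 = ≤∞-pred (subst (λ a → p Z ≤∞ fin a) x≡y+1 (x-lb Z)) not-tight
    where
    x≡y+1 : tilde x Z ≡ tilde y Z + 1ℤ
    x≡y+1 = trans (sym (ℤP.+-identityʳ _)) (sym y+1≡x+0)
    not-tight : p Z ≢ fin (tilde y Z + 1ℤ)
    not-tight pZ≡ = s∉Z (t⇒s Z (trans (cong fin x≡y+1) (sym pZ≡)) t∈Z)
  ... | yes _     | yes _   | shift = ≤∞-weaken (x-lb Z) (+≡+∧≤⇒≥ shift ℤP.≤-refl)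
  ... | no _      | yes _   | shift = ≤∞-weaken (x-lb Z) (+≡+∧≤⇒≥ shift (+≤+ z≤n))
  ... | no _      | no _    | shift = ≤∞-weaken (x-lb Z) (+≡+∧≤⇒≥ shift ℤP.≤-refl)

transfer-≡⊎< : ∀ {x : Fin n → ℤ} {s t β} → x s < β - 1ℤ → x t ≡ β →
               ∀ i → (i ≢ t × transfer s t x i ≡ x i) ⊎ transfer s t x i < β
transfer-≡⊎< {x = x} {s} {t} {β} xs<β-1 xt≡β i with s FinP.≟ i | t FinP.≟ i
... | yes refl | yes refl = ⊥-elim (ℤP.<⇒≢ (≤-1⇒< (ℤP.<⇒≤ xs<β-1)) xt≡β)
... | yes refl | no t≢s   = inj₂ (begin-strict
  x s + 1ℤ + 0ℤ  ≡⟨ ℤP.+-identityʳ _ ⟩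
  x s + 1ℤ       ≡⟨ ℤP.+-comm (x s) 1ℤ ⟩
  1ℤ + x s       ≤⟨ ℤP.i<j⇒suc[i]≤j xs<β-1 ⟩
  β - 1ℤ         <⟨ ≤-1⇒< ℤP.≤-refl ⟩
  β              ∎)
  where open ℤP.≤-Reasoning
... | no _     | yes refl =
  inj₂ (≤-1⇒< (ℤP.≤-reflexive (cong (λ r → r - 1ℤ) (trans (ℤP.+-identityʳ (x t)) xt≡β))))
... | no _     | no t≢i   = inj₁ (t≢i ∘ sym , trans (ℤP.+-identityʳ _) (ℤP.+-identityʳ (x i)))

preDecMin-hull-≥ : ∀ {p : Subset n → ℤ∞} {β m s t} → PreDecMin p β m → m t ≡ β →
                   InTightHull p m t s → β - 1ℤ ≤ m s
preDecMin-hull-≥ {β = β} {m} {s} {t} (m∈B , m≤β , m-min) mt≡β t⇒s = ℤP.≮⇒≥ fewer-β-components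
  where
  y : Fin _ → ℤ
  y = transfer s t m
  fewer-β-components : ¬ (m s < β - 1ℤ)
  fewer-β-components ms<β-1 =
    ℕP.<⇒≱ (countEq-< t y≡β⇒m≡β mt≡β yt≢β) (m-min y (transfer-InB m∈B t⇒s) y≤β)
    where
    values : ∀ i → (i ≢ t × y i ≡ m i) ⊎ y i < β
    values = transfer-≡⊎< ms<β-1 mt≡β
    y≤β : Covered β y
    y≤β i = [ (λ (_ , yi≡mi) → ℤP.≤-trans (ℤP.≤-reflexive yi≡mi) (m≤β i)) , ℤP.<⇒≤ ]′ (values i)
    y≡β⇒m≡β : ∀ i → y i ≡ β → m i ≡ β
    y≡β⇒m≡β i yi≡β =
      [ (λ (_ , yi≡mi) → trans (sym yi≡mi) yi≡β) , (λ yi<β → ⊥-elim (ℤP.<⇒≢ yi<β yi≡β)) ]′ (values i)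
    yt≢β : y t ≢ β
    yt≢β = [ (λ (t≢t , _) → ⊥-elim (t≢t refl)) , ℤP.<⇒≢ ]′ (values t)

≤β-1+𝟙 : ∀ {a β} → a ≤ β → a ≤ β - 1ℤ + 𝟙 (a ℤP.≟ β)
≤β-1+𝟙 {a} {β} a≤β with a ℤP.≟ β
... | yes refl = ℤP.≤-reflexive (sym (m-1+1≡m a))
... | no a≢β   = ℤP.≤-trans (<⇒≤-1 (ℤP.≤∧≢⇒< a≤β a≢β)) (ℤP.≤-reflexive (sym (ℤP.+-identityʳ _)))

≡β-1+𝟙 : ∀ {a β} → a ≤ β → β - 1ℤ ≤ a → a ≡ β - 1ℤ + 𝟙 (a ℤP.≟ β)
≡β-1+𝟙 {a} {β} a≤β β-1≤a with a ℤP.≟ β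
... | yes refl = sym (m-1+1≡m a)
... | no a≢β   = trans (ℤP.≤-antisym (<⇒≤-1 (ℤP.≤∧≢⇒< a≤β a≢β)) β-1≤a) (sym (ℤP.+-identityʳ _))

module _ {n} {x : Fin n → ℤ} {β : ℤ} (x≤β : Covered β x) where

  bound : Subset n → ℤ
  bound X = (β - 1ℤ) * + ∣ X ∣ + + countEq x β

  private
    w : Fin n → ℤ
    w _ = β - 1ℤ

    𝟙β : Fin n → ℤ
    𝟙β i = 𝟙 (x i ℤP.≟ β)

    bound≡∑ : ∀ X → bound X ≡ ∑[ i < n ] (sel X w i + 𝟙β i)
    bound≡∑ X = begin
      (β - 1ℤ) * + ∣ X ∣ + + countEq x β ≡⟨ cong₂ _+_ (sym (tilde-const (β - 1ℤ) X)) (countEq≡∑ x β) ⟩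
      tilde w X + sum 𝟙β                  ≡⟨ cong (λ r → r + sum 𝟙β) (tilde≡∑ w X) ⟩
      sum (sel X w) + sum 𝟙β              ≡⟨ ∑-distrib-+ (sel X w) 𝟙β ⟨
      ∑[ i < n ] (sel X w i + 𝟙β i)       ∎
      where open ≡-Reasoning

    sel-≤ : ∀ X i → sel X x i ≤ sel X w i + 𝟙β i
    sel-≤ X i with i ∈? X
    ... | yes i∈X rewrite sel-∈ x i∈X | sel-∈ w i∈X = ≤β-1+𝟙 (x≤β i)
    ... | no i∉X  rewrite sel-∉ x i∉X | sel-∉ w i∉X =
      ℤP.≤-trans (0≤𝟙 (x i ℤP.≟ β)) (ℤP.≤-reflexive (sym (ℤP.+-identityˡ _)))

  tilde≤bound : ∀ X → tilde x X ≤ bound X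
  tilde≤bound X = subst₂ _≤_ (sym (tilde≡∑ x X)) (sym (bound≡∑ X)) (∑-mono-≤ (sel-≤ X))

  tilde<bound : ∀ {X t} → t ∉ X → x t ≡ β → tilde x X < bound X
  tilde<bound {X} {t} t∉X xt≡β =
    subst₂ _<_ (sym (tilde≡∑ x X)) (sym (bound≡∑ X)) (∑-mono-< t (sel-≤ X) sel-<)
    where
    sel-< : sel X x t < sel X w t + 𝟙β t
    sel-< rewrite sel-∉ x t∉X | sel-∉ w t∉X | 𝟙-yes (x t ℤP.≟ β) xt≡β = +<+ (s≤s z≤n)

  tilde≡bound : ∀ {X} → (∀ t → x t ≡ β → t ∈ X) → (∀ s → s ∈ X → β - 1ℤ ≤ x s) → tilde x X ≡ bound X
  tilde≡bound {X} ⊇β β-1≤ = trans (tilde≡∑ x X) (trans (sum-cong-≗ sel-≡) (sym (bound≡∑ X)))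
    where
    sel-≡ : ∀ i → sel X x i ≡ sel X w i + 𝟙β i
    sel-≡ i with i ∈? X
    ... | yes i∈X rewrite sel-∈ x i∈X | sel-∈ w i∈X = ≡β-1+𝟙 (x≤β i) (β-1≤ i i∈X)
    ... | no i∉X  rewrite sel-∉ x i∉X | sel-∉ w i∉X | 𝟙-no (x i ℤP.≟ β) (i∉X ∘ ⊇β i) = refl

module _ {n} {p : Subset n → ℤ∞} (sup : Supermodular p) {x : Fin n → ℤ} (x∈B : InB p x) where

  tight-∩-∪ : ∀ {X Y} → Tight p x X → Tight p x Y → Tight p x (X ∩ Y) × Tight p x (X ∪ Y)
  tight-∩-∪ {X} {Y} tight-X tight-Y =
    Product.map sym sym (≤∞-squeeze (proj₂ x∈B (X ∩ Y)) (proj₂ x∈B (X ∪ Y)) sum-bound)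
    where
    sum-bound : fin (tilde x (X ∩ Y) + tilde x (X ∪ Y)) ≤∞ p (X ∩ Y) +∞ p (X ∪ Y)
    sum-bound = subst (_≤∞ p (X ∩ Y) +∞ p (X ∪ Y)) (cong fin (sym (tilde-modular x X Y)))
                  (subst₂ (λ u v → u +∞ v ≤∞ p (X ∩ Y) +∞ p (X ∪ Y)) (sym tight-X) (sym tight-Y) (sup X Y))

  tight? : Decidable (Tight p x)
  tight? X = fin (tilde x X) ≟∞ p X

  tightHull : Fin n → Subset n
  tightHull t = ⋂-all (λ X → tight? X ×-dec t ∈? X)

  tightHull-isTm : ∀ t → IsTm p x t (tightHull t)
  tightHull-isTm t = proj₁ closed , proj₂ closed , λ X tight-X t∈X → ⋂-all-⊆ Q? (tight-X , t∈X)
    where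
    Q? : Decidable (λ X → Tight p x X × t ∈ X)
    Q? X = tight? X ×-dec t ∈? X
    closed : Tight p x (tightHull t) × t ∈ tightHull t
    closed = ⋂-all-closed Q? (proj₁ x∈B , ∈⊤)
               (λ (tight-X , t∈X) (tight-Y , t∈Y) → proj₁ (tight-∩-∪ tight-X tight-Y) , x∈p∩q⁺ (t∈X , t∈Y))

  tight-⋃ : p ⊥ ≡ fin 0ℤ → ∀ {Xs} → All (Tight p x) Xs → Tight p x (⋃ Xs)
  tight-⋃ p⊥ = foldr-preservesᵇ (λ tight-X tight-Y → proj₂ (tight-∩-∪ tight-X tight-Y))
                 (trans (cong fin (tilde-⊥ x)) (sym p⊥))

module PeakSet {n} {p : Subset n → ℤ∞} (sup : Supermodular p) (p⊥ : p ⊥ ≡ fin 0ℤ)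
               {β : ℤ} {m : Fin n → ℤ} (pdm : PreDecMin p β m) where

  private
    m∈B : InB p m
    m∈B = proj₁ pdm
    m≤β : Covered β m
    m≤β = proj₁ (proj₂ pdm)

  Tₘ : Fin n → Subset n
  Tₘ = tightHull sup m∈B

  Tₘ-isTm : ∀ t → IsTm p m t (Tₘ t)
  Tₘ-isTm = tightHull-isTm sup m∈B

  private
    peaks : List (Fin n)
    peaks = filter (λ t → m t ℤP.≟ β) (allFinL n)

  S₁[m] : Subset n
  S₁[m] = ⋃ (map Tₘ peaks)

  ∈S₁[m]⁺ : ∀ {s t} → m t ≡ β → s ∈ Tₘ t → s ∈ S₁[m]
  ∈S₁[m]⁺ {t = t} mt≡β = ∈⋃⁺ (∈-map⁺ Tₘ (∈-filter⁺ (λ t → m t ℤP.≟ β) (∈-allFin t) mt≡β))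

  ∈S₁[m]⁻ : ∀ {s} → s ∈ S₁[m] → ∃ λ t → m t ≡ β × s ∈ Tₘ t
  ∈S₁[m]⁻ s∈S₁[m] with ∈⋃⁻ (map Tₘ peaks) s∈S₁[m]
  ... | X , X∈ , s∈X with ∈-map⁻ Tₘ X∈
  ...   | t , t∈peaks , refl = t , proj₂ (∈-filter⁻ (λ t → m t ℤP.≟ β) {xs = allFinL n} t∈peaks) , s∈X

  peak⇒∈S₁[m] : ∀ t → m t ≡ β → t ∈ S₁[m]
  peak⇒∈S₁[m] t mt≡β = ∈S₁[m]⁺ mt≡β (proj₁ (proj₂ (Tₘ-isTm t)))

  S₁[m]-tight : Tight p m S₁[m]
  S₁[m]-tight = tight-⋃ sup m∈B p⊥ (map⁺ (All.universal (proj₁ ∘ Tₘ-isTm) peaks))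

  S₁[m]-≥β-1 : ∀ s → s ∈ S₁[m] → β - 1ℤ ≤ m s
  S₁[m]-≥β-1 s s∈S₁[m] =
    let t , mt≡β , s∈Tₘt = ∈S₁[m]⁻ s∈S₁[m]
    in preDecMin-hull-≥ pdm mt≡β (λ Z tight-Z t∈Z → proj₂ (proj₂ (Tₘ-isTm t)) Z tight-Z t∈Z s∈Tₘt)

  h1-S₁[m] : h1 p β S₁[m] ≡ fin (+ countEq m β)
  h1-S₁[m] = ⊖∞-fin (trans (sym S₁[m]-tight) (cong fin (tilde≡bound m≤β peak⇒∈S₁[m] S₁[m]-≥β-1)))

  S₁[m]-maximizes : Maximizes (h1 p β) S₁[m]
  S₁[m]-maximizes Y =
    subst (h1 p β Y ≤∞_) (sym h1-S₁[m]) (⊖∞-≤ (proj₂ m∈B Y) (tilde≤bound m≤β Y))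

  maximizer-tight-⊇ : ∀ {X} → Maximizes (h1 p β) X → Tight p m X × (∀ t → m t ≡ β → t ∈ X)
  maximizer-tight-⊇ {X} X-max = sym (proj₁ sandwich) , ⊇β
    where
    sandwich : p X ≡ fin (tilde m X) × tilde m X ≡ bound m≤β X
    sandwich = ⊖∞-sandwich (proj₂ m∈B X) (tilde≤bound m≤β X)
                 (subst (_≤∞ h1 p β X) h1-S₁[m] (X-max S₁[m]))
    ⊇β : ∀ t → m t ≡ β → t ∈ X
    ⊇β t mt≡β with t ∈? X
    ... | yes t∈X = t∈X
    ... | no t∉X  = ⊥-elim (ℤP.<⇒≢ (tilde<bound m≤β t∉X mt≡β) (proj₂ sandwich))

theorem4p4 : (n : ℕ) (p : Subset (suc n) → ℤ∞) → Supermodular p → p ⊥ ≡ fin 0ℤ → (c : ℤ) → p ⊤ ≡ fin c → (β₁ : ℤ) → IsBeta1 p β₁ → (S₁ : Subset (suc n)) → IsPeakSet p β₁ S₁ → (m : Fin (suc n) → ℤ) → PreDecMin p β₁ m → IsS1m p β₁ m S₁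
theorem4p4 n p sup p⊥ _ _ β _ S₁ peak m pdm s = mk⇔ to from
  where
  open PeakSet sup p⊥ pdm
  to : s ∈ S₁ → ∃ λ t → m t ≡ β × ∃ λ T → IsTm p m t T × s ∈ T
  to s∈S₁ =
    let t , mt≡β , s∈Tₘt = ∈S₁[m]⁻ (Equivalence.to (peak s) s∈S₁ S₁[m] S₁[m]-maximizes)
    in t , mt≡β , Tₘ t , Tₘ-isTm t , s∈Tₘt
  from : (∃ λ t → m t ≡ β × ∃ λ T → IsTm p m t T × s ∈ T) → s ∈ S₁
  from (t , mt≡β , T , (_ , _ , T-least) , s∈T) = Equivalence.from (peak s) λ X X-max →
    let tight-X , ⊇β = maximizer-tight-⊇ X-max in T-least X tight-X (⊇β t mt≡β) s∈T
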